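{- Let $(F_i)_{i\in I}$ be an acyclic finite family of clause-sets. If no $F_i$ has forced assignments, then $\bigcup_{i\in I}F_i$ has no forced assignments.
   Context: Literals, clauses (finite sets of literals without complementary pairs), clause-sets; $\mathrm{var}$. For a partial assignment $\varphi$, $\varphi*F$ deletes clauses containing a true literal and deletes false literals. A clause-set $F$ has a forced assignment if there is a literal $x$ with $\langle x\to0\rangle*F$ unsatisfiable (so an unsatisfiable clause-set has forced assignments). Incidence graph of $(F_i)_{i\in I}$: bipartite graph with parts $\bigcup_i\mathrm{var}(F_i)$ and $I$, $v$ adjacent to $i$ iff $v\in\mathrm{var}(F_i)$; the family is acyclic if this graph has no cycle. -}

module Defs where

open import Data.Nat using (ℕ; zero; suc; _≡ᵇ_; _<_; _≤_; s≤s; _<?_)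
open import Data.Bool using (Bool; true; false; not; if_then_else_)
open import Data.Maybe using (Maybe; just; nothing)
open import Data.Fin using (Fin; fromℕ<; toℕ)
open import Data.List using (List; []; _∷_; concat; tabulate; filterᵇ)
open import Data.Bool.ListAction using (any)
open import Data.List.Membership.Propositional using (_∈_)
open import Data.List.Relation.Unary.All using (All)
open import Data.List.Relation.Unary.Any using (Any)
open import Data.Product using (Σ; ∃; _×_; _,_)
open import Relation.Binary.PropositionalEquality using (_≡_)
open import Relation.Nullary using (¬_; yes; no)
open import Function.Definitions using (Injective)

record Lit : Set where
  constructor lit
  field
    var : ℕ
    pos : Bool
open Lit public

compl : Lit → Lit
compl (lit v b) = lit v (not b)

-- Clauses and clause-sets are represented by finite lists (read as sets).
Clause : Set
Clause = List Lit

ClauseSet : Set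
ClauseSet = List Clause

ClashFree : Clause → Set
ClashFree C = ∀ x → x ∈ C → ¬ (compl x ∈ C)

WellFormed : ClauseSet → Set
WellFormed F = All ClashFree F

InVar : ℕ → ClauseSet → Set
InVar v F = ∃ λ C → C ∈ F × Any (λ x → var x ≡ v) C

PAss : Set
PAss = ℕ → Maybe Bool

litVal : PAss → Lit → Maybe Bool
litVal φ (lit v b) with φ v
... | nothing = nothing
... | just c  = just (if b then c else not c)

isTrue : Maybe Bool → Bool
isTrue (just true) = true
isTrue _           = false

isFalse : Maybe Bool → Bool
isFalse (just false) = true
isFalse _            = false

apply : PAss → ClauseSet → ClauseSet
apply φ [] = []
apply φ (C ∷ F) with any (λ x → isTrue (litVal φ x)) C
... | true  = apply φ F
... | false = filterᵇ (λ x → not (isFalse (litVal φ x))) C ∷ apply φ F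

falsify : Lit → PAss
falsify x v = if v ≡ᵇ var x then just (not (pos x)) else nothing

TAss : Set
TAss = ℕ → Bool

litTrue : TAss → Lit → Bool
litTrue α (lit v b) = if b then α v else not (α v)

Satisfies : TAss → ClauseSet → Set
Satisfies α F = All (λ C → Any (λ x → litTrue α x ≡ true) C) F

Satisfiable : ClauseSet → Set
Satisfiable F = ∃ λ α → Satisfies α F

HasForcedAssignment : ClauseSet → Set
HasForcedAssignment F = ∃ λ x → ¬ Satisfiable (apply (falsify x) F)

⋃ : ∀ {m} → (Fin m → ClauseSet) → ClauseSet
⋃ F = concat (tabulate F)

next : ∀ {n} → Fin (suc n) → Fin (suc n)
next {n} i with suc (toℕ i) <? suc n
... | yes p = fromℕ< p
... | no _  = Fin.zero

-- A cycle in the incidence graph of (F i)_{i : Fin m}: it is bipartite, so a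
-- cycle alternates variables and indices:
--   v₀ – i₀ – v₁ – i₁ – … – v_{k-1} – i_{k-1} – v₀   with k ≥ 2,
-- all vᵢ pairwise distinct and all iⱼ pairwise distinct, and
-- vⱼ, v_{j+1 mod k} ∈ var(F iⱼ).  Here k = suc (suc n).
record Cycle {m : ℕ} (F : Fin m → ClauseSet) : Set where
  field
    n    : ℕ
    vs   : Fin (suc (suc n)) → ℕ
    is   : Fin (suc (suc n)) → Fin m
    vs-inj : Injective _≡_ _≡_ vs
    is-inj : Injective _≡_ _≡_ is
    edge₁ : ∀ j → InVar (vs j) (F (is j))
    edge₂ : ∀ j → InVar (vs (next j)) (F (is j))

Acyclic : ∀ {m} → (Fin m → ClauseSet) → Set
Acyclic F = ¬ Cycle F

module Submission where

-- ⟨x→0⟩*G is satisfiable exactly when G has a model falsifying x, so a clause-set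
-- without forced assignments has, for every literal, a model falsifying it.  An acyclic
-- family has a leaf: a member F l meeting the others in at most one variable w.  By
-- induction the other members have a common model α falsifying a prescribed literal,
-- and F l has a model β; whichever of the two is chosen second can be made to agree
-- with the first on w, since w is not forced either.  Then β on var(F l) and α
-- elsewhere glue to a common model.  A leaf is found by growing a path in the incidence
-- graph at one end: its indices are distinct, so it cannot grow forever, and any other
-- way of getting stuck closes a cycle.

open import Defs
open import Data.Bool using (Bool; true; false; not; T; if_then_else_)
open import Data.Bool.Properties using (T?; not-injective; not-involutive)
open import Data.Bool.ListAction using (any)
open import Data.Empty using (⊥-elim)
open import Data.Fin using (Fin; toℕ; punchIn)
import Data.Fin.Properties as Fin
open import Data.Fin.Properties using (toℕ-injective; toℕ<n; toℕ-fromℕ<; punchIn-injective; punchIn-punchOut)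
open import Data.List using ([]; _∷_; filterᵇ)
open import Data.List.Membership.Propositional using (_∈_; find; lose)
open import Data.List.Membership.Propositional.Properties using (∈-filter⁺; ∈-filter⁻)
open import Data.List.Relation.Unary.All as All using ([]; _∷_)
open import Data.List.Relation.Unary.All.Properties using (concat⁺; tabulate⁺)
open import Data.List.Relation.Unary.Any as Any using (Any)
open import Data.List.Relation.Unary.Any.Properties using (any⁻)
open import Data.Maybe using (just; nothing; fromMaybe)
open import Data.Maybe.Properties using (just-injective)
open import Data.Nat using (ℕ; zero; suc; _+_; _≡ᵇ_; _<_; _≤_; s≤s; s≤s⁻¹; z≤n; _<?_)
open import Data.Nat.Properties
  using (≡ᵇ⇒≡; ≡⇒≡ᵇ; _≟_; <-≤-trans; m<n⇒m<1+n; n<1+n; m<1+n⇒m<n∨m≡n; <⇒≢; +-suc; m≤m+n)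
open import Data.Product using (∃; ∃₂; _×_; _,_)
open import Data.Sum using (_⊎_; inj₁; inj₂; [_,_]′)
open import Effect.Monad using (RawMonad)
open import Function using (_∘_; const)
open import Level using (0ℓ)
open import Relation.Binary.PropositionalEquality using (_≡_; _≢_; refl; sym; trans; cong; subst)
open import Relation.Nullary using (¬_; Dec; does; yes; no; ¬?; contradiction)
import Relation.Nullary.Decidable as Dec
open import Relation.Nullary.Decidable using (_×-dec_; decidable-stable; dec-true; dec-false)
open import Relation.Nullary.Negation using (¬¬-Monad; ¬¬-map)
open import Relation.Unary using (Decidable)

SatisfiesClause : TAss → Clause → Set
SatisfiesClause α C = Any (λ x → litTrue α x ≡ true) C

_⊒_ : TAss → PAss → Set
α ⊒ φ = ∀ v {b} → φ v ≡ just b → α v ≡ b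

_▷_ : PAss → TAss → TAss
(φ ▷ β) v = fromMaybe (β v) (φ v)

▷-⊒ : ∀ φ β → (φ ▷ β) ⊒ φ
▷-⊒ φ β v eq rewrite eq = refl

litVal-sound : ∀ {φ α} → α ⊒ φ → ∀ y {c} → litVal φ y ≡ just c → litTrue α y ≡ c
litVal-sound {φ} ext (lit v b) eq with φ v in φv
... | just c rewrite ext v φv = just-injective eq

litVal-unassigned : ∀ φ β y → litVal φ y ≡ nothing → litTrue (φ ▷ β) y ≡ litTrue β y
litVal-unassigned φ β (lit v b) eq with φ v in φv
... | nothing = refl

module _ (φ : PAss) where

  satisfiedBy : Lit → Bool
  satisfiedBy y = isTrue (litVal φ y)

  unfalsifiedBy : Lit → Bool
  unfalsifiedBy y = not (isFalse (litVal φ y))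

  satisfied-sound : ∀ β C → T (any satisfiedBy C) → SatisfiesClause (φ ▷ β) C
  satisfied-sound β C t with find (any⁻ satisfiedBy C t)
  ... | y , y∈C , ty = lose y∈C (litVal-sound (▷-⊒ φ β) y (isTrue⇒just ty))
    where
    isTrue⇒just : ∀ {m} → T (isTrue m) → m ≡ just true
    isTrue⇒just {just true} _ = refl

  unfalsified-sound : ∀ β y → T (unfalsifiedBy y) → litTrue β y ≡ true → litTrue (φ ▷ β) y ≡ true
  unfalsified-sound β y kept βy with litVal φ y in eq
  ... | nothing = trans (litVal-unassigned φ β y eq) βy
  ... | just true = litVal-sound (▷-⊒ φ β) y eq

  reduct-sound : ∀ β C → SatisfiesClause β (filterᵇ unfalsifiedBy C) → SatisfiesClause (φ ▷ β) C
  reduct-sound β C sat with find sat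
  ... | y , y∈ , βy with ∈-filter⁻ (T? ∘ unfalsifiedBy) y∈
  ... | y∈C , kept = lose y∈C (unfalsified-sound β y kept βy)

  reduct-complete : ∀ {α} → α ⊒ φ → ∀ C → SatisfiesClause α C → SatisfiesClause α (filterᵇ unfalsifiedBy C)
  reduct-complete {α} ext C sat with find sat
  ... | y , y∈C , αy = lose (∈-filter⁺ (T? ∘ unfalsifiedBy) y∈C kept) αy
    where
    kept : T (unfalsifiedBy y)
    kept with litVal φ y in eq
    ... | nothing = _
    ... | just true = _
    ... | just false with () ← trans (sym αy) (litVal-sound ext y eq)

  apply-sound : ∀ β G → Satisfies β (apply φ G) → Satisfies (φ ▷ β) G
  apply-sound β [] [] = []
  apply-sound β (C ∷ G) sat with any satisfiedBy C in eq
  apply-sound β (C ∷ G) sat | true = satisfied-sound β C (subst T (sym eq) _) ∷ apply-sound β G sat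
  apply-sound β (C ∷ G) (satC ∷ sat) | false = reduct-sound β C satC ∷ apply-sound β G sat

  apply-complete : ∀ {α} → α ⊒ φ → ∀ G → Satisfies α G → Satisfies α (apply φ G)
  apply-complete ext [] [] = []
  apply-complete ext (C ∷ G) (satC ∷ sat) with any satisfiedBy C
  ... | true = apply-complete ext G sat
  ... | false = reduct-complete ext C satC ∷ apply-complete ext G sat

falsify-self : ∀ x → litVal (falsify x) x ≡ just false
falsify-self (lit v b) with v ≡ᵇ v | ≡⇒≡ᵇ v v refl
... | true | _ with b
...   | true = refl
...   | false = refl

litTrue≡false⇒ : ∀ α w c → litTrue α (lit w c) ≡ false → α w ≡ not c
litTrue≡false⇒ α w true αx = αx
litTrue≡false⇒ α w false αx = not-injective αx

falsify-⊒ : ∀ α x → litTrue α x ≡ false → α ⊒ falsify x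
falsify-⊒ α (lit w c) αx v eq with v ≡ᵇ w in e
... | true with refl ← ≡ᵇ⇒≡ v w (subst T (sym e) _) = trans (litTrue≡false⇒ α w c αx) (just-injective eq)

falsify-▷ : ∀ x β → litTrue (falsify x ▷ β) x ≡ false
falsify-▷ x β = litVal-sound (▷-⊒ (falsify x) β) x (falsify-self x)

HasModelFalsifying : ClauseSet → Lit → Set
HasModelFalsifying G x = ∃ λ α → Satisfies α G × litTrue α x ≡ false

satisfiable-falsify⇒ : ∀ G x → Satisfiable (apply (falsify x) G) → HasModelFalsifying G x
satisfiable-falsify⇒ G x (β , sat) =
  falsify x ▷ β , apply-sound (falsify x) β G sat , falsify-▷ x β

satisfiable-falsify⇐ : ∀ G x → HasModelFalsifying G x → Satisfiable (apply (falsify x) G)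
satisfiable-falsify⇐ G x (α , sat , αx) = α , apply-complete (falsify x) (falsify-⊒ α x αx) G sat

litTrue-cong : ∀ α β x → α (var x) ≡ β (var x) → litTrue α x ≡ litTrue β x
litTrue-cong α β (lit v true) eq = eq
litTrue-cong α β (lit v false) eq = cong not eq

∈⇒InVar : ∀ {x C G} → C ∈ G → x ∈ C → InVar (var x) G
∈⇒InVar {C = C} C∈G x∈C = C , C∈G , Any.map (sym ∘ cong var) x∈C

satisfies-cong : ∀ {α β : TAss} G → (∀ u → InVar u G → α u ≡ β u) → Satisfies α G → Satisfies β G
satisfies-cong {α} {β} G agree sat = All.tabulate λ C∈G → satisfiesClause-cong C∈G (All.lookup sat C∈G)
  where
  satisfiesClause-cong : ∀ {C} → C ∈ G → SatisfiesClause α C → SatisfiesClause β C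
  satisfiesClause-cong C∈G satC with find satC
  ... | x , x∈C , αx = lose x∈C (trans (sym (litTrue-cong α β x (agree (var x) (∈⇒InVar C∈G x∈C)))) αx)

anyVar? : ∀ {P : ℕ → Set} → Decidable P → ∀ G → Dec (∃ λ u → InVar u G × P u)
anyVar? {P} P? G = Dec.map′ witness unwitness (Any.any? (Any.any? (P? ∘ var)) G)
  where
  witness : Any (Any (P ∘ var)) G → ∃ λ u → InVar u G × P u
  witness a with find a
  ... | C , C∈G , b with find b
  ... | x , x∈C , Px = var x , ∈⇒InVar C∈G x∈C , Px
  unwitness : (∃ λ u → InVar u G × P u) → Any (Any (P ∘ var)) G
  unwitness (u , (C , C∈G , occ) , Pu) = lose C∈G (Any.map (λ {x} e → subst P (sym e) Pu) occ)

InVar? : ∀ u G → Dec (InVar u G)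
InVar? u G = Dec.map′ (λ { (.u , iv , refl) → iv }) (λ iv → u , iv , refl) (anyVar? (_≟ u) G)

InjectiveBelow : {A : Set} → ℕ → (ℕ → A) → Set
InjectiveBelow n f = ∀ {a b} → a < n → b < n → f a ≡ f b → a ≡ b

FreshBelow : {A : Set} → ℕ → (ℕ → A) → A → Set
FreshBelow n f x = ∀ {a} → a < n → f a ≢ x

injectiveBelow-≤ : ∀ {A : Set} {m n} {f : ℕ → A} → m ≤ n → InjectiveBelow n f → InjectiveBelow m f
injectiveBelow-≤ m≤n inj a<m b<m = inj (<-≤-trans a<m m≤n) (<-≤-trans b<m m≤n)

_◂_ : {A : Set} → A → (ℕ → A) → ℕ → A
(x ◂ f) zero = x
(x ◂ f) (suc a) = f a

◂-injectiveBelow : ∀ {A : Set} {n} {f : ℕ → A} {x} →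
  InjectiveBelow n f → FreshBelow n f x → InjectiveBelow (suc n) (x ◂ f)
◂-injectiveBelow inj fresh {zero} {zero} _ _ _ = refl
◂-injectiveBelow inj fresh {zero} {suc b} _ (s≤s b<n) e = ⊥-elim (fresh b<n (sym e))
◂-injectiveBelow inj fresh {suc a} {zero} (s≤s a<n) _ e = ⊥-elim (fresh a<n e)
◂-injectiveBelow inj fresh {suc a} {suc b} (s≤s a<n) (s≤s b<n) e = cong suc (inj a<n b<n e)

least? : ∀ {P : ℕ → Set} → Decidable P → ∀ t →
  (∃ λ s → s < t × P s × (∀ {a} → a < s → ¬ P a)) ⊎ (∀ {s} → s < t → ¬ P s)
least? P? zero = inj₂ λ ()
least? P? (suc t) with least? P? t
... | inj₁ (s , s<t , Ps , below) = inj₁ (s , m<n⇒m<1+n s<t , Ps , below)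
... | inj₂ none with P? t
...   | yes Pt = inj₁ (t , n<1+n t , Pt , none)
...   | no ¬Pt = inj₂ λ s<1+t → [ none , (λ { refl → ¬Pt }) ]′ (m<1+n⇒m<n∨m≡n s<1+t)

module _ {M : ℕ} (F : Fin M → ClauseSet) where

  Shared : Fin M → ℕ → Set
  Shared l u = ∃ λ j → j ≢ l × InVar u (F j)

  Shared? : ∀ l u → Dec (Shared l u)
  Shared? l u = Fin.any? λ j → ¬? (j Fin.≟ l) ×-dec InVar? u (F j)

  Leaf : Fin M → ℕ → Set
  Leaf l w = ∀ u → InVar u (F l) → Shared l u → u ≡ w

  -- The cycle V 0 — I 0 — V 1 — I 1 — … — V (suc n) — I (suc n) — V 0.
  mkCycle : ∀ n (V : ℕ → ℕ) (I : ℕ → Fin M) →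
    InjectiveBelow (suc (suc n)) V → InjectiveBelow (suc (suc n)) I →
    (∀ {a} → a < suc (suc n) → InVar (V a) (F (I a))) →
    (∀ {a} → a < suc n → InVar (V (suc a)) (F (I a))) →
    InVar (V 0) (F (I (suc n))) → Cycle F
  mkCycle n V I V-inj I-inj V∈I V₊₁∈I V₀∈Iₙ = record
    { n = n
    ; vs = V ∘ toℕ
    ; is = I ∘ toℕ
    ; vs-inj = λ {j} {j′} e → toℕ-injective (V-inj (toℕ<n j) (toℕ<n j′) e)
    ; is-inj = λ {j} {j′} e → toℕ-injective (I-inj (toℕ<n j) (toℕ<n j′) e)
    ; edge₁ = λ j → V∈I (toℕ<n j)
    ; edge₂ = edge₂
    }
    where
    edge₂ : (j : Fin (suc (suc n))) → InVar (V (toℕ (next j))) (F (I (toℕ j)))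
    edge₂ j with suc (toℕ j) <? suc (suc n)
    ... | yes j+1<k rewrite toℕ-fromℕ< j+1<k = V₊₁∈I (s≤s⁻¹ j+1<k)
    ... | no j+1≮k with m<1+n⇒m<n∨m≡n (toℕ<n j)
    ...   | inj₁ j<k-1 = contradiction (s≤s j<k-1) j+1≮k
    ...   | inj₂ j≡k-1 rewrite j≡k-1 = V₀∈Iₙ

  -- A path I 0 — V 0 — I 1 — … — V (t - 1) — I t in the incidence graph.  It grows
  -- by prepending, so I 0 is the end at which it is extended.
  record Path (t : ℕ) : Set where
    field
      V : ℕ → ℕ
      I : ℕ → Fin M
      V-inj : InjectiveBelow t V
      I-inj : InjectiveBelow (suc t) I
      V∈I : ∀ {a} → a < t → InVar (V a) (F (I a))
      V∈I₊₁ : ∀ {a} → a < t → InVar (V a) (F (I (suc a)))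

  trivialPath : Fin M → Path 0
  trivialPath i = record
    { V = λ _ → 0 ; I = λ _ → i
    ; V-inj = λ () ; I-inj = λ { (s≤s z≤n) (s≤s z≤n) _ → refl }
    ; V∈I = λ () ; V∈I₊₁ = λ () }

  path-short : ∀ {t} → Path t → ¬ (M ≤ t)
  path-short {t} p M≤t with Fin.pigeonhole (n<1+n M) (Path.I p ∘ toℕ)
  ... | a , b , a<b , e = <⇒≢ a<b (Path.I-inj p (bound a) (bound b) e)
    where
    bound : (a : Fin (suc M)) → toℕ a < suc t
    bound a = <-≤-trans (toℕ<n a) (s≤s M≤t)

  module _ {t} (p : Path t) where
    open Path p

    extend : ∀ {y j} → FreshBelow t V y → FreshBelow (suc t) I j →
      InVar y (F (I 0)) → InVar y (F j) → Path (suc t)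
    extend {y} {j} y-fresh j-fresh y∈I₀ y∈j = record
      { V = y ◂ V ; I = j ◂ I
      ; V-inj = ◂-injectiveBelow V-inj y-fresh
      ; I-inj = ◂-injectiveBelow I-inj j-fresh
      ; V∈I = λ { {zero} _ → y∈j ; {suc a} (s≤s a<t) → V∈I a<t }
      ; V∈I₊₁ = λ { {zero} _ → y∈I₀ ; {suc a} (s≤s a<t) → V∈I₊₁ a<t } }

    -- The cycle y — I 0 — V 0 — I 1 — … — V s — I (suc s) — y.
    close : ∀ {s y} → s < t → FreshBelow (suc s) V y →
      InVar y (F (I 0)) → InVar y (F (I (suc s))) → Cycle F
    close {s} {y} s<t y-fresh y∈I₀ y∈Iₛ₊₁ =
      mkCycle s (y ◂ V) I
        (◂-injectiveBelow (injectiveBelow-≤ s<t V-inj) y-fresh)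
        (injectiveBelow-≤ (s≤s s<t) I-inj)
        (λ { {zero} _ → y∈I₀ ; {suc a} (s≤s a<s+1) → V∈I₊₁ (<-≤-trans a<s+1 s<t) })
        (λ a<s+1 → V∈I (<-≤-trans a<s+1 s<t))
        y∈Iₛ₊₁

    -- Unless I 0 is a leaf via V 0, some y ≢ V 0 of F (I 0) also occurs in F j, j ≢ I 0.
    -- The first I (suc s) containing y closes a cycle (minimality keeps y off the
    -- cycle's other vertices); if there is none, y and j extend the path.
    leaf-or-extend : Acyclic F → Leaf (I 0) (V 0) ⊎ Path (suc t)
    leaf-or-extend acyclic with anyVar? (λ y → ¬? (y ≟ V 0) ×-dec Shared? (I 0) y) (F (I 0))
    ... | no no-branch = inj₁ λ u u∈I₀ shared →
      decidable-stable (u ≟ V 0) λ u≢V₀ → no-branch (u , u∈I₀ , u≢V₀ , shared)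
    ... | yes (y , y∈I₀ , y≢V₀ , j , j≢I₀ , y∈j) with least? (λ s → InVar? y (F (I (suc s)))) t
    ...   | inj₁ (s , s<t , y∈Iₛ₊₁ , earlier) = ⊥-elim (acyclic (close s<t y-fresh y∈I₀ y∈Iₛ₊₁))
      where
      y-fresh : FreshBelow (suc s) V y
      y-fresh {zero} _ = y≢V₀ ∘ sym
      y-fresh {suc a} (s≤s a<s) Vₐ₊₁≡y =
        earlier a<s (subst (λ u → InVar u (F (I (suc a)))) Vₐ₊₁≡y (V∈I (<-≤-trans (s≤s a<s) s<t)))
    ...   | inj₂ never = inj₂ (extend y-fresh j-fresh y∈I₀ y∈j)
      where
      y-fresh : FreshBelow t V y
      y-fresh a<t Vₐ≡y = never a<t (subst (λ u → InVar u (F (I (suc _)))) Vₐ≡y (V∈I₊₁ a<t))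
      j-fresh : FreshBelow (suc t) I j
      j-fresh {zero} _ I₀≡j = j≢I₀ (sym I₀≡j)
      j-fresh {suc a} (s≤s a<t) Iₐ₊₁≡j = never a<t (subst (λ i → InVar y (F i)) (sym Iₐ₊₁≡j) y∈j)

  leaf-from-path : Acyclic F → ∀ k {t} → Path t → M ≤ k + t → ∃₂ Leaf
  leaf-from-path acyclic zero p M≤t = ⊥-elim (path-short p M≤t)
  leaf-from-path acyclic (suc k) {t} p M≤k+t with leaf-or-extend p acyclic
  ... | inj₁ leaf = _ , _ , leaf
  ... | inj₂ p′ = leaf-from-path acyclic k p′ (subst (M ≤_) (sym (+-suc k t)) M≤k+t)

leaf-exists : ∀ {m} (F : Fin (suc m) → ClauseSet) → Acyclic F → ∃₂ (Leaf F)
leaf-exists {m} F acyclic = leaf-from-path F acyclic (suc m) (trivialPath F Fin.zero) (m≤m+n (suc m) 0)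

glue : ClauseSet → TAss → TAss → TAss
glue G β α u = if does (InVar? u G) then β u else α u

glue-inside : ∀ G β α {u} → InVar u G → glue G β α u ≡ β u
glue-inside G β α {u} u∈G = cong (if_then β u else α u) (dec-true (InVar? u G) u∈G)

glue-outside : ∀ G β α {u} → ¬ InVar u G → glue G β α u ≡ α u
glue-outside G β α {u} u∉G = cong (if_then β u else α u) (dec-false (InVar? u G) u∉G)

module _ {M : ℕ} (F : Fin M → ClauseSet) {l : Fin M} {w : ℕ} (leaf : Leaf F l w) where

  glue-satisfies : ∀ {α β} → α w ≡ β w → (∀ i → i ≢ l → Satisfies α (F i)) → Satisfies β (F l) →
    ∀ i → Satisfies (glue (F l) β α) (F i)
  glue-satisfies {α} {β} αw≡βw α⊨ β⊨ i with i Fin.≟ l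
  ... | yes refl = satisfies-cong (F l) (λ u u∈Fₗ → sym (glue-inside (F l) β α u∈Fₗ)) β⊨
  ... | no i≢l = satisfies-cong (F i) agree (α⊨ i i≢l)
    where
    agree : ∀ u → InVar u (F i) → α u ≡ glue (F l) β α u
    agree u u∈Fᵢ with InVar? u (F l)
    ... | yes u∈Fₗ with refl ← leaf u u∈Fₗ (i , i≢l , u∈Fᵢ) = trans αw≡βw (sym (glue-inside (F l) β α u∈Fₗ))
    ... | no u∉Fₗ = sym (glue-outside (F l) β α u∉Fₗ)

HasCommonModelFalsifying : ∀ {m} → (Fin m → ClauseSet) → Lit → Set
HasCommonModelFalsifying F x = ∃ λ α → (∀ i → Satisfies α (F i)) × litTrue α x ≡ false

∀-punchIn⇒∀-≢ : ∀ {m} {P : Fin (suc m) → Set} l → (∀ j → P (punchIn l j)) → ∀ i → i ≢ l → P i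
∀-punchIn⇒∀-≢ {P = P} l P-punchIn i i≢l = subst P (punchIn-punchOut (i≢l ∘ sym)) (P-punchIn _)

cycle-punchIn : ∀ {m} (F : Fin (suc m) → ClauseSet) l → Cycle (F ∘ punchIn l) → Cycle F
cycle-punchIn F l c = record
  { n = n ; vs = vs ; is = punchIn l ∘ is
  ; vs-inj = vs-inj ; is-inj = is-inj ∘ punchIn-injective l _ _
  ; edge₁ = edge₁ ; edge₂ = edge₂ }
  where open Cycle c

litTrue-lit-not≡false⇒ : ∀ α w b → litTrue α (lit w (not b)) ≡ false → α w ≡ b
litTrue-lit-not≡false⇒ α w b e = trans (litTrue≡false⇒ α w (not b) e) (not-involutive b)

-- Not being forced yields models only under ¬ ¬, so the gluing runs in that monad.
open RawMonad (¬¬-Monad {a = 0ℓ})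

glue-at-leaf : ∀ {m} (F : Fin (suc m) → ClauseSet) {l w} → Leaf F l w →
  (∀ x → ¬ ¬ HasModelFalsifying (F l) x) →
  (∀ x → ¬ ¬ HasCommonModelFalsifying (F ∘ punchIn l) x) →
  ∀ x → ¬ ¬ HasCommonModelFalsifying F x
glue-at-leaf F {l} {w} leaf leaf-free rest-free x with InVar? (var x) (F l)
... | yes x∈Fₗ = do
  β , β⊨ , βx ← leaf-free x
  α , α⊨ , αw ← rest-free (lit w (not (β w)))
  pure (glue (F l) β α ,
        glue-satisfies F leaf (litTrue-lit-not≡false⇒ α w (β w) αw) (∀-punchIn⇒∀-≢ l α⊨) β⊨ ,
        trans (litTrue-cong (glue (F l) β α) β x (glue-inside (F l) β α x∈Fₗ)) βx)
... | no x∉Fₗ = do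
  α , α⊨ , αx ← rest-free x
  β , β⊨ , βw ← leaf-free (lit w (not (α w)))
  pure (glue (F l) β α ,
        glue-satisfies F leaf (sym (litTrue-lit-not≡false⇒ β w (α w) βw)) (∀-punchIn⇒∀-≢ l α⊨) β⊨ ,
        trans (litTrue-cong (glue (F l) β α) α x (glue-outside (F l) β α x∉Fₗ)) αx)

acyclic⇒common-model : ∀ m (F : Fin m → ClauseSet) → Acyclic F →
  (∀ i x → ¬ ¬ HasModelFalsifying (F i) x) → ∀ x → ¬ ¬ HasCommonModelFalsifying F x
acyclic⇒common-model zero F _ _ x = pure (falsify x ▷ const true , (λ ()) , falsify-▷ x (const true))
acyclic⇒common-model (suc m) F acyclic free with leaf-exists F acyclic
... | l , w , leaf = glue-at-leaf F leaf (free l)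
  (acyclic⇒common-model m (F ∘ punchIn l) (acyclic ∘ cycle-punchIn F l) (free ∘ punchIn l))

¬forced⇒¬¬model : ∀ G → ¬ HasForcedAssignment G → ∀ x → ¬ ¬ HasModelFalsifying G x
¬forced⇒¬¬model G unforced x no-model = unforced (x , no-model ∘ satisfiable-falsify⇒ G x)

¬¬model⇒¬forced : ∀ G → (∀ x → ¬ ¬ HasModelFalsifying G x) → ¬ HasForcedAssignment G
¬¬model⇒¬forced G free (x , unsat) = free x (unsat ∘ satisfiable-falsify⇐ G x)

satisfies-⋃ : ∀ {m α} (F : Fin m → ClauseSet) → (∀ i → Satisfies α (F i)) → Satisfies α (⋃ F)
satisfies-⋃ F = concat⁺ ∘ tabulate⁺

lemma4p5 : (m : ℕ) (F : Fin m → ClauseSet) →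
    (∀ i → WellFormed (F i)) →
    Acyclic F →
    (∀ i → ¬ HasForcedAssignment (F i)) →
    ¬ HasForcedAssignment (⋃ F)
lemma4p5 m F _ acyclic unforced = ¬¬model⇒¬forced (⋃ F) λ x →
  ¬¬-map (λ (α , α⊨ , αx) → α , satisfies-⋃ F α⊨ , αx)
    (acyclic⇒common-model m F acyclic (λ i → ¬forced⇒¬¬model (F i) (unforced i)) x)
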